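{- For any two (finite, simple) graphs $G$ and $H$, $$\Gamma_3(G \oplus H) \cong \Gamma_3(G) \oplus \Gamma_3(H) \oplus (\Gamma_2(G) \square H) \oplus (\Gamma_2(H) \square G).$$
   Context: All graphs are finite, simple and undirected. For a graph $G$ and a natural number $k$, the $k$-token graph $\Gamma_k(G)$ has as vertex set the collection of all $k$-element subsets of $V(G)$ (it is the graph with no vertices if $|V(G)|<k$), and two distinct $k$-subsets $A,B$ are adjacent if and only if $A \triangle B = \{x,y\}$ with $xy \in E(G)$. $G \oplus H$ denotes the disjoint union of $G$ and $H$, and $G \square H$ denotes the Cartesian product: vertex set $V(G)\times V(H)$, with $(g,h)$ adjacent to $(g',h')$ iff either $g=g'$ and $hh' \in E(H)$, or $h=h'$ and $gg'\in E(G)$. -}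

module Defs where

open import Data.Nat using (ℕ; _+_)
open import Data.Fin using (Fin; splitAt)
open import Data.Fin.Subset using (Subset; _∈_; _∉_; ∣_∣)
open import Data.Product using (Σ; Σ-syntax; _×_; _,_; proj₁; proj₂)
open import Data.Sum using (_⊎_; inj₁; inj₂)
open import Data.Empty using (⊥)
open import Relation.Nullary using (¬_)
open import Relation.Binary.PropositionalEquality using (_≡_; refl; sym; subst)
open import Function.Bundles using (_↔_; _⇔_; Inverse; mk⇔; Equivalence)

-- A simple graph on vertex type V: symmetric, irreflexive adjacency relation.
-- Finite graphs are those with V = Fin n.
record Graph (V : Set) : Set₁ where
  field
    E       : V → V → Set
    E-sym   : ∀ {x y} → E x y → E y x
    E-irrefl : ∀ {x} → ¬ E x x
open Graph public

record _≅_ {V W : Set} (G : Graph V) (H : Graph W) : Set where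
  field
    iso      : V ↔ W
    preserve : ∀ x y → E G x y ⇔ E H (Inverse.to iso x) (Inverse.to iso y)

_⊕_ : {V W : Set} → Graph V → Graph W → Graph (V ⊎ W)
_⊕_ {V} {W} G H = record { E = R ; E-sym = λ {x} {y} → s {x} {y} ; E-irrefl = λ {x} → i {x} }
  where
  R : V ⊎ W → V ⊎ W → Set
  R (inj₁ a) (inj₁ b) = E G a b
  R (inj₂ a) (inj₂ b) = E H a b
  R _ _ = ⊥
  s : ∀ {x y} → R x y → R y x
  s {inj₁ a} {inj₁ b} e = E-sym G e
  s {inj₂ a} {inj₂ b} e = E-sym H e
  i : ∀ {x} → ¬ R x x
  i {inj₁ a} = E-irrefl G
  i {inj₂ a} = E-irrefl H

_⊕ᶠ_ : {n m : ℕ} → Graph (Fin n) → Graph (Fin m) → Graph (Fin (n + m))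
_⊕ᶠ_ {n} {m} G H = record
  { E = λ x y → E U (splitAt n x) (splitAt n y)
  ; E-sym = λ {x} {y} → E-sym U {splitAt n x} {splitAt n y}
  ; E-irrefl = λ {x} → E-irrefl U {splitAt n x} }
  where U = G ⊕ H

_□_ : {V W : Set} → Graph V → Graph W → Graph (V × W)
_□_ {V} {W} G H = record { E = R ; E-sym = λ {x} {y} → s {x} {y} ; E-irrefl = λ {x} → i {x} }
  where
  R : V × W → V × W → Set
  R (g , h) (g' , h') = (g ≡ g' × E H h h') ⊎ (h ≡ h' × E G g g')
  s : ∀ {x y} → R x y → R y x
  s {_ , _} {_ , _} (inj₁ (p , e)) = inj₁ (sym p , E-sym H e)
  s {_ , _} {_ , _} (inj₂ (p , e)) = inj₂ (sym p , E-sym G e)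
  i : ∀ {x} → ¬ R x x
  i {_ , _} (inj₁ (_ , e)) = E-irrefl H e
  i {_ , _} (inj₂ (_ , e)) = E-irrefl G e

KSubset : ℕ → ℕ → Set
KSubset n k = Σ[ A ∈ Subset n ] ∣ A ∣ ≡ k

_∈△_,_ : {n : ℕ} → Fin n → Subset n → Subset n → Set
z ∈△ A , B = (z ∈ A × z ∉ B) ⊎ (z ∉ A × z ∈ B)

△-swap : {n : ℕ} {z : Fin n} {A B : Subset n} → z ∈△ A , B → z ∈△ B , A
△-swap (inj₁ (p , q)) = inj₂ (q , p)
△-swap (inj₂ (p , q)) = inj₁ (q , p)

⊎-swap : {X Y : Set} → X ⊎ Y → Y ⊎ X
⊎-swap (inj₁ x) = inj₂ x
⊎-swap (inj₂ y) = inj₁ y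

Γ : {n : ℕ} → (k : ℕ) → Graph (Fin n) → Graph (KSubset n k)
Γ {n} k G = record { E = R ; E-sym = λ {x} {y} → s {x} {y} ; E-irrefl = λ {x} → i {x} }
  where
  R : KSubset n k → KSubset n k → Set
  R (A , _) (B , _) = Σ[ x ∈ Fin n ] Σ[ y ∈ Fin n ]
    (E G x y × (∀ z → (z ∈△ A , B) ⇔ (z ≡ x ⊎ z ≡ y)))
  s : ∀ {P Q} → R P Q → R Q P
  s {_ , _} {_ , _} (x , y , e , f) = y , x , E-sym G e ,
    λ z → mk⇔ (λ d → ⊎-swap (Equivalence.to (f z) (△-swap d)))
              (λ w → △-swap (Equivalence.from (f z) (⊎-swap w)))
  i : ∀ {P} → ¬ R P P
  i {_ , _} (x , y , e , f) with Equivalence.from (f x) (inj₁ refl)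
  ... | inj₁ (p , q) = q p
  ... | inj₂ (p , q) = p q

{-# OPTIONS --safe #-}
module Submission where

-- A set of tokens on G ⊕ H is a pair (a , b) of token sets on G and on H, and a move
-- slides one token along an edge of G or of H, leaving the other side fixed. Hence the
-- token graph on all subsets of V(G ⊕ H) is the Cartesian product of those of G and H,
-- and Γ₃(G ⊕ H) is its restriction to the pairs with |a| + |b| = 3. Moves preserve |a|,
-- so this splits by (|a| , |b|) ∈ {(3,0), (0,3), (2,1), (1,2)}; a side holding a single
-- token is just a vertex, and moving a single token is moving along an edge, which gives
-- the summands Γ₃(G), Γ₃(H), Γ₂(G) □ H and Γ₂(H) □ G.

open import Defs
open import Data.Bool using (Bool; true; false)
open import Data.Bool.Properties using (¬-not; not-¬)
open import Data.Empty using (⊥-elim)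
open import Data.Fin using (Fin; zero; suc; splitAt)
open import Data.Fin.Properties using (+↔⊎)
open import Data.Fin.Subset using (Subset; ⁅_⁆; ∣_∣; _∈_; _∉_; inside; outside) renaming (⊥ to ∅)
open import Data.Fin.Subset.Properties using (∣⊥∣≡0; ∣⁅x⁆∣≡1; x∈⁅x⁆; x∈⁅y⁆⇒x≡y; x∈⁅y⁆⇔x≡y)
open import Data.Nat using (ℕ; suc; _+_)
open import Data.Nat.Properties using (suc-injective; +-cancelʳ-≡; ≡-irrelevant)
open import Data.Product using (Σ; Σ-syntax; _×_; _,_; proj₁)
open import Data.Product.Function.NonDependent.Propositional using (_×-⇔_)
open import Data.Product.Properties using (×-≡,≡→≡)
open import Data.Sum using (_⊎_; inj₁; inj₂; [_,_]′; swap)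
open import Data.Sum.Function.Propositional using (_⊎-⇔_)
open import Data.Sum.Properties using (inj₁-injective; inj₂-injective)
open import Data.Vec using (_∷_; []; _++_; lookup; take; drop)
open import Data.Vec.Properties using ([]=↔lookup; lookup-splitAt; take++drop≡id; ++-injective)
open import Data.Vec.Relation.Binary.Pointwise.Extensional using (ext; Pointwise-≡↔≡)
open import Function using (_∘_; case_of_)
open import Function.Bundles using (_↔_; _⇔_; Inverse; mk⇔; mk↔ₛ′; Equivalence)
open import Function.Properties.Equivalence using (⇔-setoid)
open import Function.Properties.Inverse using (↔-sym; ↔-trans; ↔⇒⇔)
open import Level using (0ℓ)
open import Relation.Binary.Bundles using (Setoid)
open import Relation.Binary.PropositionalEquality
open import Relation.Nullary using (¬_)
open import Relation.Nullary.Irrelevant using (Irrelevant)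
import Relation.Binary.Reasoning.Setoid as SetoidReasoning

open Setoid (⇔-setoid 0ℓ) using () renaming (refl to ⇔-refl; sym to ⇔-sym; trans to ⇔-trans)
open Equivalence using (to; from)

¬-⇔ : {A B : Set} → ¬ A → ¬ B → A ⇔ B
¬-⇔ ¬a ¬b = mk⇔ (⊥-elim ∘ ¬a) (⊥-elim ∘ ¬b)

Σ-≡-irrelevant : {A : Set} {P : A → Set} → (∀ {x} → Irrelevant (P x)) →
                 {u v : Σ A P} → proj₁ u ≡ proj₁ v → u ≡ v
Σ-≡-irrelevant irr {x , p} {.x , q} refl = cong (x ,_) (irr p q)

Differ : Bool → Bool → Set
Differ p q = (p ≡ true × q ≡ false) ⊎ (p ≡ false × q ≡ true)

Differ-irrefl : ∀ {p} → ¬ Differ p p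
Differ-irrefl (inj₁ (refl , ()))
Differ-irrefl (inj₂ (refl , ()))

Differ-sym : ∀ {p q} → Differ p q → Differ q p
Differ-sym (inj₁ (p , q)) = inj₂ (q , p)
Differ-sym (inj₂ (p , q)) = inj₁ (q , p)

¬Differ⇒≡ : ∀ p q → ¬ Differ p q → p ≡ q
¬Differ⇒≡ true  true  _ = refl
¬Differ⇒≡ false false _ = refl
¬Differ⇒≡ true  false d = ⊥-elim (d (inj₁ (refl , refl)))
¬Differ⇒≡ false true  d = ⊥-elim (d (inj₂ (refl , refl)))

≡⇒¬Differ : ∀ {p q} → p ≡ q → ¬ Differ p q
≡⇒¬Differ refl = Differ-irrefl

Differ⇔either : ∀ {p q} → ¬ (p ≡ true × q ≡ true) → Differ p q ⇔ (p ≡ true ⊎ q ≡ true)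
Differ⇔either {true}  {true}  ¬both = ⊥-elim (¬both (refl , refl))
Differ⇔either {true}  {false} _     = mk⇔ (λ _ → inj₁ refl) (λ _ → inj₁ (refl , refl))
Differ⇔either {false} {true}  _     = mk⇔ (λ _ → inj₂ refl) (λ _ → inj₂ (refl , refl))
Differ⇔either {false} {false} _     = ¬-⇔ Differ-irrefl λ { (inj₁ ()) ; (inj₂ ()) }

-- Token configurations are indicator functions V → Bool rather than subsets, so that
-- they live on any vertex type and transport along Fin (n + m) ↔ Fin n ⊎ Fin m.
TokenMove : {V : Set} → (V → V → Set) → (V → Bool) → (V → Bool) → Set
TokenMove {V} R P Q =
  Σ[ x ∈ V ] Σ[ y ∈ V ] (R x y × (∀ z → Differ (P z) (Q z) ⇔ (z ≡ x ⊎ z ≡ y)))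

module _ {V : Set} {R : V → V → Set} where

  TokenMove-irrefl : ∀ {P} → ¬ TokenMove R P P
  TokenMove-irrefl (x , _ , _ , f) = Differ-irrefl (from (f x) (inj₁ refl))

  TokenMove-sym : (∀ {x y} → R x y → R y x) → ∀ {P Q} → TokenMove R P Q → TokenMove R Q P
  TokenMove-sym R-sym (x , y , r , f) = y , x , R-sym r , λ z →
    mk⇔ (swap ∘ to (f z) ∘ Differ-sym) (Differ-sym ∘ from (f z) ∘ swap)

  TokenMove-cong : ∀ {P P' Q Q'} → P ≗ P' → Q ≗ Q' → TokenMove R P Q ⇔ TokenMove R P' Q'
  TokenMove-cong P≗P' Q≗Q' = mk⇔ (move P≗P' Q≗Q') (move (sym ∘ P≗P') (sym ∘ Q≗Q'))
    where
    move : ∀ {P P' Q Q'} → P ≗ P' → Q ≗ Q' → TokenMove R P Q → TokenMove R P' Q'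
    move P≗P' Q≗Q' (x , y , r , f) = x , y , r , λ z →
      subst₂ (λ p q → Differ p q ⇔ (z ≡ x ⊎ z ≡ y)) (P≗P' z) (Q≗Q' z) (f z)

module _ {V W : Set} (φ : V ↔ W) where
  open Inverse φ using (strictlyInverseˡ; inverseˡ; inverseʳ) renaming (to to φ→; from to φ←)

  private
    φ→≡⇔≡φ← : ∀ {v w} → φ→ v ≡ w ⇔ v ≡ φ← w
    φ→≡⇔≡φ← = mk⇔ (λ e → sym (inverseʳ (sym e))) inverseˡ

    φ←≡⇔≡φ→ : ∀ {v w} → φ← w ≡ v ⇔ w ≡ φ→ v
    φ←≡⇔≡φ→ = mk⇔ (λ e → sym (inverseˡ (sym e))) inverseʳ

  TokenMove-↔ : (R : W → W → Set) (P Q : W → Bool) →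
                TokenMove R P Q ⇔ TokenMove (λ x y → R (φ→ x) (φ→ y)) (P ∘ φ→) (Q ∘ φ→)
  TokenMove-↔ R P Q = mk⇔ pull push
    where
    pull : TokenMove R P Q → TokenMove (λ x y → R (φ→ x) (φ→ y)) (P ∘ φ→) (Q ∘ φ→)
    pull (u , v , r , f) =
      φ← u , φ← v , subst₂ R (sym (strictlyInverseˡ u)) (sym (strictlyInverseˡ v)) r ,
      λ z → ⇔-trans (f (φ→ z)) (φ→≡⇔≡φ← ⊎-⇔ φ→≡⇔≡φ←)
    push : TokenMove (λ x y → R (φ→ x) (φ→ y)) (P ∘ φ→) (Q ∘ φ→) → TokenMove R P Q
    push (x , y , r , f) = φ→ x , φ→ y , r , λ w →
      subst (λ w' → Differ (P w') (Q w') ⇔ (w ≡ φ→ x ⊎ w ≡ φ→ y)) (strictlyInverseˡ w)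
            (⇔-trans (f (φ← w)) (φ←≡⇔≡φ→ ⊎-⇔ φ←≡⇔≡φ→))

module _ {V W : Set} (G : Graph V) (H : Graph W) where

  TokenMove-⊕ : (P Q : V → Bool) (P' Q' : W → Bool) →
    TokenMove (E (G ⊕ H)) [ P , P' ]′ [ Q , Q' ]′ ⇔
    ((P ≗ Q × TokenMove (E H) P' Q') ⊎ (P' ≗ Q' × TokenMove (E G) P Q))
  TokenMove-⊕ P Q P' Q' = mk⇔ split join
    where
    inj₁≡⇔ : ∀ {x y : V} → inj₁ {B = W} x ≡ inj₁ y ⇔ x ≡ y
    inj₁≡⇔ = mk⇔ inj₁-injective (cong inj₁)
    inj₂≡⇔ : ∀ {x y : W} → inj₂ {A = V} x ≡ inj₂ y ⇔ x ≡ y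
    inj₂≡⇔ = mk⇔ inj₂-injective (cong inj₂)

    split : TokenMove (E (G ⊕ H)) [ P , P' ]′ [ Q , Q' ]′ →
            (P ≗ Q × TokenMove (E H) P' Q') ⊎ (P' ≗ Q' × TokenMove (E G) P Q)
    split (inj₁ x , inj₁ y , e , f) =
      inj₂ ( (λ w → ¬Differ⇒≡ _ _ λ d → case to (f (inj₂ w)) d of λ { (inj₁ ()) ; (inj₂ ()) })
           , (x , y , e , λ z → ⇔-trans (f (inj₁ z)) (inj₁≡⇔ ⊎-⇔ inj₁≡⇔)) )
    split (inj₂ x , inj₂ y , e , f) =
      inj₁ ( (λ v → ¬Differ⇒≡ _ _ λ d → case to (f (inj₁ v)) d of λ { (inj₁ ()) ; (inj₂ ()) })
           , (x , y , e , λ z → ⇔-trans (f (inj₂ z)) (inj₂≡⇔ ⊎-⇔ inj₂≡⇔)) )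
    split (inj₁ _ , inj₂ _ , () , _)
    split (inj₂ _ , inj₁ _ , () , _)

    join : (P ≗ Q × TokenMove (E H) P' Q') ⊎ (P' ≗ Q' × TokenMove (E G) P Q) →
           TokenMove (E (G ⊕ H)) [ P , P' ]′ [ Q , Q' ]′
    join (inj₂ (P'≗Q' , (x , y , e , f))) = inj₁ x , inj₁ y , e , λ
      { (inj₁ z) → ⇔-trans (f z) (⇔-sym (inj₁≡⇔ ⊎-⇔ inj₁≡⇔))
      ; (inj₂ w) → ¬-⇔ (≡⇒¬Differ (P'≗Q' w)) λ { (inj₁ ()) ; (inj₂ ()) } }
    join (inj₁ (P≗Q , (x , y , e , f))) = inj₂ x , inj₂ y , e , λ
      { (inj₂ z) → ⇔-trans (f z) (⇔-sym (inj₂≡⇔ ⊎-⇔ inj₂≡⇔))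
      ; (inj₁ v) → ¬-⇔ (≡⇒¬Differ (P≗Q v)) λ { (inj₁ ()) ; (inj₂ ()) } }

TokenGraph : ∀ {n} → Graph (Fin n) → Graph (Subset n)
TokenGraph G = record
  { E        = λ A B → TokenMove (E G) (lookup A) (lookup B)
  ; E-sym    = TokenMove-sym (E-sym G)
  ; E-irrefl = TokenMove-irrefl
  }

module _ {n : ℕ} where

  ∈⇔lookup≡true : ∀ {A : Subset n} {z} → z ∈ A ⇔ lookup A z ≡ true
  ∈⇔lookup≡true = ↔⇒⇔ []=↔lookup

  ∉⇔lookup≡false : ∀ {A : Subset n} {z} → z ∉ A ⇔ lookup A z ≡ false
  ∉⇔lookup≡false = mk⇔ (λ z∉A → ¬-not (z∉A ∘ from ∈⇔lookup≡true))
                       (λ eq → not-¬ eq ∘ to ∈⇔lookup≡true)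

  ∈△⇔Differ : ∀ {A B : Subset n} {z} → (z ∈△ A , B) ⇔ Differ (lookup A z) (lookup B z)
  ∈△⇔Differ = (∈⇔lookup≡true ×-⇔ ∉⇔lookup≡false) ⊎-⇔ (∉⇔lookup≡false ×-⇔ ∈⇔lookup≡true)

  Γ-edge⇔ : ∀ {k} (G : Graph (Fin n)) (X Y : KSubset n k) →
            E (Γ k G) X Y ⇔ E (TokenGraph G) (proj₁ X) (proj₁ Y)
  Γ-edge⇔ G (A , _) (B , _) = mk⇔
    (λ (x , y , e , f) → x , y , e , λ z → ⇔-trans (⇔-sym ∈△⇔Differ) (f z))
    (λ (x , y , e , f) → x , y , e , λ z → ⇔-trans ∈△⇔Differ (f z))

  lookup-⁅⁆ : ∀ {x y : Fin n} → lookup ⁅ y ⁆ x ≡ true ⇔ x ≡ y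
  lookup-⁅⁆ = ⇔-trans (⇔-sym ∈⇔lookup≡true) x∈⁅y⁆⇔x≡y

  ⁅⁆-Differ : ∀ {h h' : Fin n} → h ≢ h' → ∀ z →
              Differ (lookup ⁅ h ⁆ z) (lookup ⁅ h' ⁆ z) ⇔ (z ≡ h ⊎ z ≡ h')
  ⁅⁆-Differ h≢h' z = ⇔-trans
    (Differ⇔either (λ (e , e') → h≢h' (trans (sym (to lookup-⁅⁆ e)) (to lookup-⁅⁆ e'))))
    (lookup-⁅⁆ ⊎-⇔ lookup-⁅⁆)

  ⁅⁆-edge⇔ : (G : Graph (Fin n)) {h h' : Fin n} → E (TokenGraph G) ⁅ h ⁆ ⁅ h' ⁆ ⇔ E G h h'
  ⁅⁆-edge⇔ G {h} {h'} = mk⇔ edge move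
    where
    move : E G h h' → E (TokenGraph G) ⁅ h ⁆ ⁅ h' ⁆
    move e = h , h' , e , ⁅⁆-Differ (λ { refl → E-irrefl G e })

    -- h and h' are the two places where ⁅ h ⁆ and ⁅ h' ⁆ differ, so {h , h'} = {x , y}.
    edge : E (TokenGraph G) ⁅ h ⁆ ⁅ h' ⁆ → E G h h'
    edge m@(x , y , e , f) = match (moved h (inj₁ refl)) (moved h' (inj₂ refl))
      where
      h≢h' : h ≢ h'
      h≢h' refl = TokenMove-irrefl m
      moved : ∀ z → z ≡ h ⊎ z ≡ h' → z ≡ x ⊎ z ≡ y
      moved z = to (f z) ∘ from (⁅⁆-Differ h≢h' z)
      match : h ≡ x ⊎ h ≡ y → h' ≡ x ⊎ h' ≡ y → E G h h'
      match (inj₁ refl) (inj₂ refl) = e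
      match (inj₂ refl) (inj₁ refl) = E-sym G e
      match (inj₁ refl) (inj₁ refl) = ⊥-elim (h≢h' refl)
      match (inj₂ refl) (inj₂ refl) = ⊥-elim (h≢h' refl)

  lookup-≗⇔≡ : ∀ {A B : Subset n} → lookup A ≗ lookup B ⇔ A ≡ B
  lookup-≗⇔≡ = mk⇔ (to Pointwise-≡↔≡ ∘ ext) (λ { refl _ → refl })

module _ {n m : ℕ} (G : Graph (Fin n)) (H : Graph (Fin m)) where
  open SetoidReasoning (⇔-setoid 0ℓ)

  TokenGraph-⊕ᶠ : (a a' : Subset n) (b b' : Subset m) →
    E (TokenGraph (G ⊕ᶠ H)) (a ++ b) (a' ++ b') ⇔ E (TokenGraph G □ TokenGraph H) (a , b) (a' , b')
  TokenGraph-⊕ᶠ a a' b b' = begin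
    TokenMove (E (G ⊕ᶠ H)) (lookup (a ++ b)) (lookup (a' ++ b'))
      ≈⟨ TokenMove-cong (lookup-splitAt n a b) (lookup-splitAt n a' b') ⟩
    TokenMove (E (G ⊕ᶠ H)) ([ lookup a , lookup b ]′ ∘ splitAt n) ([ lookup a' , lookup b' ]′ ∘ splitAt n)
      ≈⟨ TokenMove-↔ +↔⊎ (E (G ⊕ H)) _ _ ⟨
    TokenMove (E (G ⊕ H)) [ lookup a , lookup b ]′ [ lookup a' , lookup b' ]′
      ≈⟨ TokenMove-⊕ G H _ _ _ _ ⟩
    ((lookup a ≗ lookup a' × TokenMove (E H) (lookup b) (lookup b')) ⊎
     (lookup b ≗ lookup b' × TokenMove (E G) (lookup a) (lookup a')))
      ≈⟨ (lookup-≗⇔≡ ×-⇔ ⇔-refl) ⊎-⇔ (lookup-≗⇔≡ ×-⇔ ⇔-refl) ⟩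
    E (TokenGraph G □ TokenGraph H) (a , b) (a' , b') ∎

∣p++q∣≡∣p∣+∣q∣ : ∀ {n m} (p : Subset n) (q : Subset m) → ∣ p ++ q ∣ ≡ ∣ p ∣ + ∣ q ∣
∣p++q∣≡∣p∣+∣q∣ []            q = refl
∣p++q∣≡∣p∣+∣q∣ (inside ∷ p)  q = cong suc (∣p++q∣≡∣p∣+∣q∣ p q)
∣p++q∣≡∣p∣+∣q∣ (outside ∷ p) q = ∣p++q∣≡∣p∣+∣q∣ p q

∣p∣≡0⇒p≡∅ : ∀ {n} {p : Subset n} → ∣ p ∣ ≡ 0 → p ≡ ∅
∣p∣≡0⇒p≡∅ {p = []}          _  = refl
∣p∣≡0⇒p≡∅ {p = outside ∷ p} eq = cong (outside ∷_) (∣p∣≡0⇒p≡∅ eq)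

element : ∀ {n} (p : Subset n) → ∣ p ∣ ≡ 1 → Fin n
element (inside ∷ _)  _  = zero
element (outside ∷ p) eq = suc (element p eq)

⁅element⁆ : ∀ {n} (p : Subset n) (eq : ∣ p ∣ ≡ 1) → ⁅ element p eq ⁆ ≡ p
⁅element⁆ (inside ∷ p)  eq = cong (inside ∷_) (sym (∣p∣≡0⇒p≡∅ (suc-injective eq)))
⁅element⁆ (outside ∷ p) eq = cong (outside ∷_) (⁅element⁆ p eq)

element-⁅⁆ : ∀ {n} (x : Fin n) (eq : ∣ ⁅ x ⁆ ∣ ≡ 1) → element ⁅ x ⁆ eq ≡ x
element-⁅⁆ zero    _  = refl
element-⁅⁆ (suc x) eq = cong suc (element-⁅⁆ x eq)

⁅⁆-≡⇔ : ∀ {n} {x y : Fin n} → x ≡ y ⇔ ⁅ x ⁆ ≡ ⁅ y ⁆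
⁅⁆-≡⇔ {x = x} {y} = mk⇔ (cong ⁅_⁆) (λ eq → x∈⁅y⁆⇒x≡y y (subst (x ∈_) eq (x∈⁅x⁆ x)))

KSubset-≡⇔ : ∀ {n k} {X Y : KSubset n k} → X ≡ Y ⇔ proj₁ X ≡ proj₁ Y
KSubset-≡⇔ = mk⇔ (cong proj₁) (Σ-≡-irrelevant ≡-irrelevant)

Induced : {V : Set} → Graph V → (P : V → Set) → Graph (Σ V P)
Induced G P = record
  { E        = λ u v → E G (proj₁ u) (proj₁ v)
  ; E-sym    = E-sym G
  ; E-irrefl = E-irrefl G
  }

≅-trans : {U V W : Set} {F : Graph U} {G : Graph V} {H : Graph W} → F ≅ G → G ≅ H → F ≅ H
≅-trans φ ψ = record
  { iso      = ↔-trans (iso φ) (iso ψ)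
  ; preserve = λ x y → ⇔-trans (preserve φ x y) (preserve ψ _ _)
  }
  where open _≅_

≅-sym : {V W : Set} {G : Graph V} {H : Graph W} → G ≅ H → H ≅ G
≅-sym {G = G} {H} φ = record
  { iso      = ↔-sym iso
  ; preserve = λ x y →
      subst₂ (λ x' y' → E H x' y' ⇔ E G (from′ x) (from′ y)) (strictlyInverseˡ x) (strictlyInverseˡ y)
             (⇔-sym (preserve (from′ x) (from′ y)))
  }
  where
  open _≅_ φ
  open Inverse iso using (strictlyInverseˡ) renaming (from to from′)

□-edgeˡ : {V W : Set} {G : Graph V} (H : Graph W) {g g' : V} {h : W} →
          E (G □ H) (g , h) (g' , h) ⇔ E G g g'
□-edgeˡ H = mk⇔ (λ { (inj₁ (_ , e)) → ⊥-elim (E-irrefl H e) ; (inj₂ (_ , e)) → e })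
                (λ e → inj₂ (refl , e))

□-edgeʳ : {V W : Set} (G : Graph V) {H : Graph W} {g : V} {h h' : W} →
          E (G □ H) (g , h) (g , h') ⇔ E H h h'
□-edgeʳ G = mk⇔ (λ { (inj₁ (_ , e)) → e ; (inj₂ (_ , e)) → ⊥-elim (E-irrefl G e) })
                (λ e → inj₁ (refl , e))

□-edge-swap : {V W : Set} {G : Graph V} {H : Graph W} {g g' : V} {h h' : W} →
              E (G □ H) (g , h) (g' , h') ⇔ E (H □ G) (h , g) (h' , g')
□-edge-swap = mk⇔ swap swap

□-edge-map : {V V' W W' : Set} {G : Graph V} {G' : Graph V'} {H : Graph W} {H' : Graph W'}
  {f : V → V'} {g : W → W'} →
  (∀ {x x'} → x ≡ x' ⇔ f x ≡ f x') → (∀ {x x'} → E G x x' ⇔ E G' (f x) (f x')) →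
  (∀ {y y'} → y ≡ y' ⇔ g y ≡ g y') → (∀ {y y'} → E H y y' ⇔ E H' (g y) (g y')) →
  ∀ {x x' y y'} → E (G □ H) (x , y) (x' , y') ⇔ E (G' □ H') (f x , g y) (f x' , g y')
□-edge-map f≡ fE g≡ gE = (f≡ ×-⇔ gE) ⊎-⇔ (g≡ ×-⇔ fE)

TotalSize : ∀ {n m} → ℕ → Subset n × Subset m → Set
TotalSize k (a , b) = ∣ a ∣ + ∣ b ∣ ≡ k

SplitΓ : ∀ {n m} (k : ℕ) → Graph (Fin n) → Graph (Fin m) → Graph (Σ (Subset n × Subset m) (TotalSize k))
SplitΓ k G H = Induced (TokenGraph G □ TokenGraph H) (TotalSize k)

module _ {n m : ℕ} (G : Graph (Fin n)) (H : Graph (Fin m)) where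

  SplitΓ≅Γ-⊕ᶠ : ∀ k → SplitΓ k G H ≅ Γ k (G ⊕ᶠ H)
  SplitΓ≅Γ-⊕ᶠ k = record
    { iso      = mk↔ₛ′ join split join-split split-join
    ; preserve = λ u v → ⇔-sym (⇔-trans (Γ-edge⇔ (G ⊕ᶠ H) (join u) (join v)) (edge u v))
    }
    where
    join : Σ (Subset n × Subset m) (TotalSize k) → KSubset (n + m) k
    join ((a , b) , eq) = a ++ b , trans (∣p++q∣≡∣p∣+∣q∣ a b) eq

    split : KSubset (n + m) k → Σ (Subset n × Subset m) (TotalSize k)
    split (A , eq) = (take n A , drop n A) ,
      trans (sym (∣p++q∣≡∣p∣+∣q∣ (take n A) (drop n A))) (trans (cong ∣_∣ (take++drop≡id n A)) eq)

    join-split : ∀ X → join (split X) ≡ X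
    join-split (A , _) = Σ-≡-irrelevant ≡-irrelevant (take++drop≡id n A)

    edge : ∀ u v → E (TokenGraph (G ⊕ᶠ H)) (proj₁ (join u)) (proj₁ (join v)) ⇔ E (SplitΓ k G H) u v
    edge ((a , b) , _) ((a' , b') , _) = TokenGraph-⊕ᶠ G H a a' b b'

    split-join : ∀ u → split (join u) ≡ u
    split-join ((a , b) , _) = Σ-≡-irrelevant ≡-irrelevant
      (×-≡,≡→≡ (++-injective (take n (a ++ b)) a (take++drop≡id n (a ++ b))))

  SplitΓ-edge⇒∣proj₁∣≡ : ∀ {k} {u v : Σ (Subset n × Subset m) (TotalSize k)} →
                          E (SplitΓ k G H) u v → ∣ proj₁ (proj₁ u) ∣ ≡ ∣ proj₁ (proj₁ v) ∣
  SplitΓ-edge⇒∣proj₁∣≡ (inj₁ (refl , _)) = refl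
  SplitΓ-edge⇒∣proj₁∣≡ {u = (a , b) , eq} {(a' , _) , eq'} (inj₂ (refl , _)) =
    +-cancelʳ-≡ (∣ b ∣) (∣ a ∣) (∣ a' ∣) (trans eq (sym eq'))

DecompositionVertex : ℕ → ℕ → Set
DecompositionVertex n m = ((KSubset n 3 ⊎ KSubset m 3) ⊎ (KSubset n 2 × Fin m)) ⊎ (KSubset m 2 × Fin n)

pattern all-in-G X   = inj₁ (inj₁ (inj₁ X))
pattern all-in-H Y   = inj₁ (inj₁ (inj₂ Y))
pattern two-in-G X h = inj₁ (inj₂ (X , h))
pattern two-in-H Y g = inj₂ (Y , g)

module _ {n m : ℕ} where

  split-of : DecompositionVertex n m → Σ (Subset n × Subset m) (TotalSize 3)
  split-of (all-in-G (a , p))   = (a , ∅) , cong₂ _+_ p (∣⊥∣≡0 m)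
  split-of (all-in-H (b , q))   = (∅ , b) , cong₂ _+_ (∣⊥∣≡0 n) q
  split-of (two-in-G (a , p) h) = (a , ⁅ h ⁆) , cong₂ _+_ p (∣⁅x⁆∣≡1 h)
  split-of (two-in-H (b , q) g) = (⁅ g ⁆ , b) , cong₂ _+_ (∣⁅x⁆∣≡1 g) q

  tokens-in-G : DecompositionVertex n m → ℕ
  tokens-in-G (all-in-G _)   = 3
  tokens-in-G (all-in-H _)   = 0
  tokens-in-G (two-in-G _ _) = 2
  tokens-in-G (two-in-H _ _) = 1

  ∣split-of∣ : ∀ t → ∣ proj₁ (proj₁ (split-of t)) ∣ ≡ tokens-in-G t
  ∣split-of∣ (all-in-G (_ , p))   = p
  ∣split-of∣ (all-in-H _)         = ∣⊥∣≡0 n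
  ∣split-of∣ (two-in-G (_ , p) _) = p
  ∣split-of∣ (two-in-H _ g)       = ∣⁅x⁆∣≡1 g

  -- i stands for ∣ a ∣, abstracted so that it can be matched on.
  classifyAt : (a : Subset n) (b : Subset m) (i : ℕ) → ∣ a ∣ ≡ i → i + ∣ b ∣ ≡ 3 → DecompositionVertex n m
  classifyAt a b 0 p q = all-in-H (b , q)
  classifyAt a b 1 p q = two-in-H (b , suc-injective q) (element a p)
  classifyAt a b 2 p q = two-in-G (a , p) (element b (suc-injective (suc-injective q)))
  classifyAt a b 3 p q = all-in-G (a , p)
  classifyAt a b (suc (suc (suc (suc _)))) p ()

  classifyAt-irrelevant : ∀ a b {i j} (p : ∣ a ∣ ≡ i) (p' : ∣ a ∣ ≡ j) q q' →
                          classifyAt a b i p q ≡ classifyAt a b j p' q'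
  classifyAt-irrelevant a b p p' q q' with trans (sym p) p'
  ... | refl rewrite ≡-irrelevant p p' | ≡-irrelevant q q' = refl

  classify : Σ (Subset n × Subset m) (TotalSize 3) → DecompositionVertex n m
  classify ((a , b) , q) = classifyAt a b ∣ a ∣ refl q

  split-of-classifyAt : ∀ a b i p q → proj₁ (split-of (classifyAt a b i p q)) ≡ (a , b)
  split-of-classifyAt a b 0 p q = cong (_, b) (sym (∣p∣≡0⇒p≡∅ p))
  split-of-classifyAt a b 1 p q = cong (_, b) (⁅element⁆ a p)
  split-of-classifyAt a b 2 p q = cong (a ,_) (⁅element⁆ b _)
  split-of-classifyAt a b 3 p q = cong (a ,_) (sym (∣p∣≡0⇒p≡∅ (suc-injective (suc-injective (suc-injective q)))))
  split-of-classifyAt a b (suc (suc (suc (suc _)))) p ()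

  classify-split-of : ∀ t → classify (split-of t) ≡ t
  classify-split-of (all-in-G (a , p)) = classifyAt-irrelevant a ∅ refl p _ (cong (3 +_) (∣⊥∣≡0 m))
  classify-split-of (all-in-H (b , q)) = classifyAt-irrelevant ∅ b refl (∣⊥∣≡0 n) _ q
  classify-split-of (two-in-G (a , p) h) = trans
    (classifyAt-irrelevant a ⁅ h ⁆ refl p _ (cong (2 +_) (∣⁅x⁆∣≡1 h)))
    (cong (two-in-G (a , p)) (element-⁅⁆ h _))
  classify-split-of (two-in-H (b , q) g) = trans
    (classifyAt-irrelevant ⁅ g ⁆ b refl (∣⁅x⁆∣≡1 g) _ (cong suc q))
    (cong₂ (λ Y g → two-in-H Y g) (Σ-≡-irrelevant ≡-irrelevant refl) (element-⁅⁆ g _))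

  split-of-↔ : DecompositionVertex n m ↔ Σ (Subset n × Subset m) (TotalSize 3)
  split-of-↔ = mk↔ₛ′ split-of classify
    (λ ((a , b) , q) → Σ-≡-irrelevant ≡-irrelevant (split-of-classifyAt a b ∣ a ∣ refl q))
    classify-split-of

module _ {n m : ℕ} (G : Graph (Fin n)) (H : Graph (Fin m)) where

  Decomposition : Graph (DecompositionVertex n m)
  Decomposition = ((Γ 3 G ⊕ Γ 3 H) ⊕ (Γ 2 G □ H)) ⊕ (Γ 2 H □ G)

  private
    no-edge : ∀ t t' → ¬ E Decomposition t t' → tokens-in-G t ≢ tokens-in-G t' →
              E Decomposition t t' ⇔ E (SplitΓ 3 G H) (split-of t) (split-of t')
    no-edge t t' ¬e ≢ = ¬-⇔ ¬e λ e → ≢ (trans (sym (∣split-of∣ t))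
      (trans (SplitΓ-edge⇒∣proj₁∣≡ G H {u = split-of t} {split-of t'} e) (∣split-of∣ t')))

  split-of-edge⇔ : ∀ t t' → E Decomposition t t' ⇔ E (SplitΓ 3 G H) (split-of t) (split-of t')
  split-of-edge⇔ (all-in-G X) (all-in-G Y) =
    ⇔-trans (Γ-edge⇔ G X Y) (⇔-sym (□-edgeˡ {G = TokenGraph G} (TokenGraph H)))
  split-of-edge⇔ (all-in-H X) (all-in-H Y) =
    ⇔-trans (Γ-edge⇔ H X Y) (⇔-sym (□-edgeʳ (TokenGraph G) {H = TokenGraph H}))
  split-of-edge⇔ (two-in-G _ _) (two-in-G _ _) =
    □-edge-map {G = Γ 2 G} {TokenGraph G} {H} {TokenGraph H} {proj₁} {⁅_⁆}
               KSubset-≡⇔ (λ {X Y} → Γ-edge⇔ G X Y) ⁅⁆-≡⇔ (⇔-sym (⁅⁆-edge⇔ H))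
  split-of-edge⇔ (two-in-H _ _) (two-in-H _ _) = ⇔-trans
    (□-edge-map {G = Γ 2 H} {TokenGraph H} {G} {TokenGraph G} {proj₁} {⁅_⁆}
                KSubset-≡⇔ (λ {X Y} → Γ-edge⇔ H X Y) ⁅⁆-≡⇔ (⇔-sym (⁅⁆-edge⇔ G)))
    (□-edge-swap {G = TokenGraph H} {TokenGraph G})
  split-of-edge⇔ t@(all-in-G _)   t'@(all-in-H _)   = no-edge t t' (λ ()) (λ ())
  split-of-edge⇔ t@(all-in-G _)   t'@(two-in-G _ _) = no-edge t t' (λ ()) (λ ())
  split-of-edge⇔ t@(all-in-G _)   t'@(two-in-H _ _) = no-edge t t' (λ ()) (λ ())
  split-of-edge⇔ t@(all-in-H _)   t'@(all-in-G _)   = no-edge t t' (λ ()) (λ ())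
  split-of-edge⇔ t@(all-in-H _)   t'@(two-in-G _ _) = no-edge t t' (λ ()) (λ ())
  split-of-edge⇔ t@(all-in-H _)   t'@(two-in-H _ _) = no-edge t t' (λ ()) (λ ())
  split-of-edge⇔ t@(two-in-G _ _) t'@(all-in-G _)   = no-edge t t' (λ ()) (λ ())
  split-of-edge⇔ t@(two-in-G _ _) t'@(all-in-H _)   = no-edge t t' (λ ()) (λ ())
  split-of-edge⇔ t@(two-in-G _ _) t'@(two-in-H _ _) = no-edge t t' (λ ()) (λ ())
  split-of-edge⇔ t@(two-in-H _ _) t'@(all-in-G _)   = no-edge t t' (λ ()) (λ ())
  split-of-edge⇔ t@(two-in-H _ _) t'@(all-in-H _)   = no-edge t t' (λ ()) (λ ())
  split-of-edge⇔ t@(two-in-H _ _) t'@(two-in-G _ _) = no-edge t t' (λ ()) (λ ())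

  Decomposition≅SplitΓ : Decomposition ≅ SplitΓ 3 G H
  Decomposition≅SplitΓ = record { iso = split-of-↔ ; preserve = split-of-edge⇔ }

theorem1 : {n m : ℕ} (G : Graph (Fin n)) (H : Graph (Fin m)) →
    Γ 3 (G ⊕ᶠ H) ≅ (((Γ 3 G ⊕ Γ 3 H) ⊕ (Γ 2 G □ H)) ⊕ (Γ 2 H □ G))
theorem1 G H = ≅-sym (≅-trans (Decomposition≅SplitΓ G H) (SplitΓ≅Γ-⊕ᶠ G H 3))
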